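{- Let $G$ be a connected split graph with split partition $(K,I)$, where $K$ is a clique, $I$ is an independent set and $|K|=\omega(G)\ge 2$. Then $\chi_d(G)=\chi_{td}(G)$.
   Context: $\omega(G)$ is the clique number of $G$. A dominator coloring of $G$ is a proper vertex coloring such that every vertex is adjacent to all vertices of some color class or forms a color class by itself (i.e. every vertex dominates, via its closed neighbourhood, some color class); $\chi_d(G)$ is the minimum number of colors in a dominator coloring. A total dominator coloring (TD-coloring) of a graph without isolated vertices is a proper vertex coloring in which every vertex is adjacent to all vertices of some color class; $\chi_{td}(G)$ is the minimum number of colors in a TD-coloring. -}

module Defs where

open import Data.Nat using (ℕ; _≤_)
open import Data.Fin using (Fin)
open import Data.Fin.Subset using (Subset; _∈_; _∉_; ∣_∣; ∁)
open import Data.Product using (Σ; ∃; _×_)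
open import Data.Sum using (_⊎_)
open import Relation.Nullary using (¬_; Dec)
open import Relation.Binary.PropositionalEquality using (_≡_; _≢_)
open import Function.Bundles using (_⇔_)

record Graph (n : ℕ) : Set₁ where
  field
    Adj   : Fin n → Fin n → Set
    adj?  : ∀ u v → Dec (Adj u v)
    sym   : ∀ {u v} → Adj u v → Adj v u
    irrefl : ∀ {v} → ¬ Adj v v
open Graph public

module _ {n : ℕ} (G : Graph n) where

  data Reach (u : Fin n) : Fin n → Set where
    here : Reach u u
    step : ∀ {v w} → Reach u v → Adj G v w → Reach u w

  Connected : Set
  Connected = ∀ u v → Reach u v

  IsClique : Subset n → Set
  IsClique S = ∀ u v → u ∈ S → v ∈ S → u ≢ v → Adj G u v

  IsIndependent : Subset n → Set
  IsIndependent S = ∀ u v → u ∈ S → v ∈ S → ¬ Adj G u v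

  IsMaxClique : Subset n → Set
  IsMaxClique S = IsClique S × (∀ T → IsClique T → ∣ T ∣ ≤ ∣ S ∣)

  IsSplitPartition : Subset n → Set
  IsSplitPartition K = IsClique K × IsIndependent (∁ K)

  Proper : {k : ℕ} → (Fin n → Fin k) → Set
  Proper c = ∀ u v → Adj G u v → c u ≢ c v

  NonEmptyClass : {k : ℕ} → (Fin n → Fin k) → Fin k → Set
  NonEmptyClass c i = ∃ λ u → c u ≡ i

  ClosedDominates : {k : ℕ} → (Fin n → Fin k) → Fin n → Fin k → Set
  ClosedDominates c v i = ∀ u → c u ≡ i → u ≡ v ⊎ Adj G v u

  OpenDominates : {k : ℕ} → (Fin n → Fin k) → Fin n → Fin k → Set
  OpenDominates c v i = ∀ u → c u ≡ i → Adj G v u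

  IsDominatorColoring : {k : ℕ} → (Fin n → Fin k) → Set
  IsDominatorColoring c =
    Proper c × (∀ v → ∃ λ i → NonEmptyClass c i × ClosedDominates c v i)

  IsTDColoring : {k : ℕ} → (Fin n → Fin k) → Set
  IsTDColoring c =
    Proper c × (∀ v → ∃ λ i → NonEmptyClass c i × OpenDominates c v i)

  HasDominatorColoring : ℕ → Set
  HasDominatorColoring k = Σ (Fin n → Fin k) IsDominatorColoring

  HasTDColoring : ℕ → Set
  HasTDColoring k = Σ (Fin n → Fin k) IsTDColoring

  IsChiD : ℕ → Set
  IsChiD k = HasDominatorColoring k × (∀ m → HasDominatorColoring m → k ≤ m)

  IsChiTD : ℕ → Set
  IsChiTD k = HasTDColoring k × (∀ m → HasTDColoring m → k ≤ m)

module Submission where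

-- A total dominator colouring is a dominator colouring, so χ_d ≤ χ_td always; the
-- content is turning a dominator colouring c of a connected split graph into a
-- total one with the same colours. A colouring is total as soon as every vertex of
-- I has a neighbour in K that is alone in its colour class: a vertex v of K
-- adjacent to everything dominates the class of another clique vertex, and if v
-- misses some w ∈ I, it is adjacent to the singleton neighbour of w. If some
-- vertex v of I is alone in its class, recolour all of I with the colour of v:
-- this stays proper, and now every vertex of K is alone in its class, while every
-- vertex of I has a neighbour in K by connectivity. Otherwise, the class dominated
-- by a vertex w of I lies in N(w) ⊆ K, hence is a singleton since c is proper on
-- the clique K.

open import Defs hiding (sym)
open import Data.Nat using (ℕ; _≤_; s≤s)
open import Data.Nat.Properties using (≤-trans; ≤-reflexive)
open import Data.Fin using (Fin; _≟_)
open import Data.Fin.Properties using (any?; all?)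
open import Data.Fin.Subset using (Subset; ∣_∣; _∈_; _∉_; ⁅_⁆)
open import Data.Fin.Subset.Properties
  using (_∈?_; x∉p⇒x∈∁p; x∈⁅x⁆; ∣⁅x⁆∣≡1; p⊆q⇒∣p∣≤∣q∣)
open import Data.Product using (∃; _×_; _,_; proj₁; proj₂)
open import Data.Sum using (_⊎_; inj₁; inj₂; [_,_]′)
open import Data.Empty using (⊥; ⊥-elim)
open import Relation.Nullary using (¬_; Dec; yes; no)
open import Relation.Nullary.Decidable using (_×-dec_; _⊎-dec_; _→-dec_; ¬?; decidable-stable)
open import Relation.Binary.PropositionalEquality using (_≡_; _≢_; refl; sym; subst)
open Relation.Binary.PropositionalEquality.≡-Reasoning
open import Function using (_∘_; id)
open import Function.Bundles using (_⇔_; mk⇔)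

reach⇒∃-neighbour : ∀ {n} (G : Graph n) {u v} → Reach G u v → u ≢ v → ∃ λ w → Adj G u w
reach⇒∃-neighbour G here u≢u = ⊥-elim (u≢u refl)
reach⇒∃-neighbour G {u} (step {v} r v~w) u≢w with u ≟ v
... | yes refl = _ , v~w
... | no u≢v = reach⇒∃-neighbour G r u≢v

td⇒dominator : ∀ {n} (G : Graph n) {m} → HasTDColoring G m → HasDominatorColoring G m
td⇒dominator G (c , proper , dom) =
  c , proper , λ v → let (i , nonEmpty , od) = dom v in i , nonEmpty , λ u cu≡i → inj₂ (od u cu≡i)

SingletonClass : ∀ {n m} → (Fin n → Fin m) → Fin n → Set
SingletonClass c y = ∀ u → c u ≡ c y → u ≡ y

singletonClass? : ∀ {n m} (c : Fin n → Fin m) y → Dec (SingletonClass c y)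
singletonClass? c y = all? (λ u → (c u ≟ c y) →-dec (u ≟ y))

∣p∣≥2⇒∃-other : ∀ {n} {p : Subset n} → 2 ≤ ∣ p ∣ → ∀ x → ∃ λ z → z ∈ p × z ≢ x
∣p∣≥2⇒∃-other {p = p} 2≤∣p∣ x with any? (λ z → (z ∈? p) ×-dec ¬? (z ≟ x))
... | yes other = other
... | no none = ⊥-elim (1+1≰1 (≤-trans 2≤∣p∣ (≤-trans (p⊆q⇒∣p∣≤∣q∣ p⊆⁅x⁆) (≤-reflexive (∣⁅x⁆∣≡1 x)))))
  where
  1+1≰1 : ¬ (2 ≤ 1)
  1+1≰1 (s≤s ())
  p⊆⁅x⁆ : ∀ {z} → z ∈ p → z ∈ ⁅ x ⁆
  p⊆⁅x⁆ {z} z∈p with z ≟ x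
  ... | yes refl = x∈⁅x⁆ x
  ... | no z≢x = ⊥-elim (none (z , z∈p , z≢x))

module SplitGraph {n : ℕ} (G : Graph n) (K : Subset n) (split : IsSplitPartition G K) where

  private
    clique : IsClique G K
    clique = proj₁ split

  ¬adj-outside : ∀ {u v} → u ∉ K → v ∉ K → ¬ Adj G u v
  ¬adj-outside {u} {v} u∉K v∉K = proj₂ split u v (x∉p⇒x∈∁p u∉K) (x∉p⇒x∈∁p v∉K)

  ∃-neighbour-in-K : 2 ≤ ∣ K ∣ → Connected G → ∀ w → w ∉ K → ∃ λ y → y ∈ K × Adj G w y
  ∃-neighbour-in-K 2≤∣K∣ conn w w∉K with ∣p∣≥2⇒∃-other {p = K} 2≤∣K∣ w
  ... | z , _ , z≢w with reach⇒∃-neighbour G (conn w z) (z≢w ∘ sym)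
  ... | y , w~y with y ∈? K
  ...   | yes y∈K = y , y∈K , w~y
  ...   | no y∉K = ⊥-elim (¬adj-outside w∉K y∉K w~y)

  module _ {m} {c : Fin n → Fin m} (proper : Proper G c) where

    proper-injective-on-K : ∀ {u v} → u ∈ K → v ∈ K → c u ≡ c v → u ≡ v
    proper-injective-on-K {u} {v} u∈K v∈K cu≡cv with u ≟ v
    ... | yes u≡v = u≡v
    ... | no u≢v = ⊥-elim (proper u v (clique u v u∈K v∈K u≢v) cu≡cv)

    HasSingletonNeighbourInK : Fin n → Set
    HasSingletonNeighbourInK w = ∃ λ y → y ∈ K × Adj G w y × SingletonClass c y

    singletonNeighbours⇒td : 2 ≤ ∣ K ∣ → (∀ w → w ∉ K → HasSingletonNeighbourInK w) →
                             IsTDColoring G c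
    singletonNeighbours⇒td 2≤∣K∣ outside = proper , dominates
      where
      dominatesSingleton : ∀ {v y} → Adj G v y → SingletonClass c y →
                           ∃ λ i → NonEmptyClass G c i × OpenDominates G c v i
      dominatesSingleton {v} {y} v~y single =
        c y , (y , refl) , λ u cu≡cy → subst (Adj G v) (sym (single u cu≡cy)) v~y

      universalCase : ∀ {v} → v ∈ K → (∃ λ z → z ∈ K × z ≢ v) → (∀ u → u ≡ v ⊎ Adj G v u) →
                      ∃ λ i → NonEmptyClass G c i × OpenDominates G c v i
      universalCase v∈K (z , z∈K , z≢v) v-universal =
        c z , (z , refl) , λ u cu≡cz → [ (λ { refl → ⊥-elim (proper _ z v~z cu≡cz) }) , id ]′ (v-universal u)
        where
        v~z = clique _ z v∈K z∈K (z≢v ∘ sym)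

      Misses : Fin n → Fin n → Set
      Misses v w = ¬ (w ≡ v ⊎ Adj G v w)

      outside-K : ∀ {v w} → v ∈ K → Misses v w → w ∉ K
      outside-K {v} {w} v∈K v≁w w∈K with w ≟ v
      ... | yes w≡v = v≁w (inj₁ w≡v)
      ... | no w≢v = v≁w (inj₂ (clique v w v∈K w∈K (w≢v ∘ sym)))

      nonNeighbourCase : ∀ {v w} → v ∈ K → Misses v w → HasSingletonNeighbourInK w →
                         ∃ λ i → NonEmptyClass G c i × OpenDominates G c v i
      nonNeighbourCase {v} v∈K v≁w (y , y∈K , w~y , single) with y ≟ v
      ... | yes refl = ⊥-elim (v≁w (inj₂ (Graph.sym G w~y)))
      ... | no y≢v = dominatesSingleton (clique v y v∈K y∈K (y≢v ∘ sym)) single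

      dominates : ∀ v → ∃ λ i → NonEmptyClass G c i × OpenDominates G c v i
      dominates v with v ∈? K
      ... | no v∉K = let (y , _ , v~y , single) = outside v v∉K in dominatesSingleton v~y single
      ... | yes v∈K with any? (λ u → ¬? ((u ≟ v) ⊎-dec adj? G v u))
      ...   | yes (w , v≁w) = nonNeighbourCase v∈K v≁w (outside w (outside-K v∈K v≁w))
      ...   | no ∄v≁ = universalCase v∈K (∣p∣≥2⇒∃-other {p = K} 2≤∣K∣ v)
                         (λ u → decidable-stable ((u ≟ v) ⊎-dec adj? G v u) (λ v≁u → ∄v≁ (u , v≁u)))

    dominator⇒singletonOrSingletonNeighbour :
      (∀ v → ∃ λ i → NonEmptyClass G c i × ClosedDominates G c v i) →
      ∀ w → w ∉ K → SingletonClass c w ⊎ HasSingletonNeighbourInK w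
    dominator⇒singletonOrSingletonNeighbour dom w w∉K with dom w
    ... | _ , (u₀ , refl) , dominated with dominated u₀ refl
    ...   | inj₁ refl =
            inj₁ λ u cu≡cw → [ id , (λ w~u → ⊥-elim (proper w u w~u (sym cu≡cw))) ]′ (dominated u cu≡cw)
    ...   | inj₂ w~u₀ with u₀ ∈? K
    ...     | no u₀∉K = ⊥-elim (¬adj-outside w∉K u₀∉K w~u₀)
    ...     | yes u₀∈K = inj₂ (u₀ , u₀∈K , w~u₀ , λ u cu≡cu₀ → alone u cu≡cu₀ (dominated u cu≡cu₀))
      where
      alone : ∀ u → c u ≡ c u₀ → u ≡ w ⊎ Adj G w u → u ≡ u₀
      alone u cu≡cu₀ (inj₁ refl) = ⊥-elim (proper w u₀ w~u₀ cu≡cu₀)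
      alone u cu≡cu₀ (inj₂ w~u) with u ∈? K
      ... | yes u∈K = proper-injective-on-K u∈K u₀∈K cu≡cu₀
      ... | no u∉K = ⊥-elim (¬adj-outside w∉K u∉K w~u)

  recolourOutside : ∀ {m} → (Fin n → Fin m) → Fin m → Fin n → Fin m
  recolourOutside c a w with w ∈? K
  ... | yes _ = c w
  ... | no _ = a

  recolourOutside-∈ : ∀ {m} (c : Fin n → Fin m) a {w} → w ∈ K → recolourOutside c a w ≡ c w
  recolourOutside-∈ c a {w} w∈K with w ∈? K
  ... | yes _ = refl
  ... | no w∉K = ⊥-elim (w∉K w∈K)

  recolourOutside-∉ : ∀ {m} (c : Fin n → Fin m) a {w} → w ∉ K → recolourOutside c a w ≡ a
  recolourOutside-∉ c a {w} w∉K with w ∈? K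
  ... | yes w∈K = ⊥-elim (w∉K w∈K)
  ... | no _ = refl

  module _ {m} {c : Fin n → Fin m} (proper : Proper G c)
           {v₀ : Fin n} (v₀∉K : v₀ ∉ K) (v₀-alone : SingletonClass c v₀) where

    private
      c′ : Fin n → Fin m
      c′ = recolourOutside c (c v₀)

      ¬sameColour-v₀ : ∀ {y} → y ∈ K → c y ≢ c v₀
      ¬sameColour-v₀ {y} y∈K cy≡cv₀ = v₀∉K (subst (_∈ K) (v₀-alone y cy≡cv₀) y∈K)

    recolourOutside-proper : Proper G c′
    recolourOutside-proper u v u~v c′u≡c′v = byMembership (u ∈? K) (v ∈? K)
      where
      byMembership : Dec (u ∈ K) → Dec (v ∈ K) → ⊥
      byMembership (yes u∈K) (yes v∈K) = proper u v u~v (begin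
          c u  ≡⟨ sym (recolourOutside-∈ c (c v₀) u∈K) ⟩
          c′ u ≡⟨ c′u≡c′v ⟩
          c′ v ≡⟨ recolourOutside-∈ c (c v₀) v∈K ⟩
          c v  ∎)
      byMembership (yes u∈K) (no v∉K) = ¬sameColour-v₀ u∈K (begin
          c u  ≡⟨ sym (recolourOutside-∈ c (c v₀) u∈K) ⟩
          c′ u ≡⟨ c′u≡c′v ⟩
          c′ v ≡⟨ recolourOutside-∉ c (c v₀) v∉K ⟩
          c v₀ ∎)
      byMembership (no u∉K) (yes v∈K) = ¬sameColour-v₀ v∈K (begin
          c v  ≡⟨ sym (recolourOutside-∈ c (c v₀) v∈K) ⟩
          c′ v ≡⟨ sym c′u≡c′v ⟩
          c′ u ≡⟨ recolourOutside-∉ c (c v₀) u∉K ⟩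
          c v₀ ∎)
      byMembership (no u∉K) (no v∉K) = ¬adj-outside u∉K v∉K u~v

    recolourOutside-singleton-on-K : ∀ {y} → y ∈ K → SingletonClass c′ y
    recolourOutside-singleton-on-K {y} y∈K u c′u≡c′y = byMembership (u ∈? K)
      where
      byMembership : Dec (u ∈ K) → u ≡ y
      byMembership (yes u∈K) = proper-injective-on-K proper u∈K y∈K (begin
          c u  ≡⟨ sym (recolourOutside-∈ c (c v₀) u∈K) ⟩
          c′ u ≡⟨ c′u≡c′y ⟩
          c′ y ≡⟨ recolourOutside-∈ c (c v₀) y∈K ⟩
          c y  ∎)
      byMembership (no u∉K) = ⊥-elim (¬sameColour-v₀ y∈K (begin
          c y  ≡⟨ sym (recolourOutside-∈ c (c v₀) y∈K) ⟩
          c′ y ≡⟨ sym c′u≡c′y ⟩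
          c′ u ≡⟨ recolourOutside-∉ c (c v₀) u∉K ⟩
          c v₀ ∎))

  dominator⇒td : ∀ {m} → 2 ≤ ∣ K ∣ → Connected G → HasDominatorColoring G m → HasTDColoring G m
  dominator⇒td 2≤∣K∣ conn (c , proper , dom)
    with any? (λ w → ¬? (w ∈? K) ×-dec singletonClass? c w)
  ... | yes (v₀ , v₀∉K , v₀-alone) =
        recolourOutside c (c v₀) ,
        singletonNeighbours⇒td (recolourOutside-proper proper v₀∉K v₀-alone) 2≤∣K∣
          λ w w∉K → let (y , y∈K , w~y) = ∃-neighbour-in-K 2≤∣K∣ conn w w∉K in
                    y , y∈K , w~y , recolourOutside-singleton-on-K proper v₀∉K v₀-alone y∈K
  ... | no noneAlone =
        c , singletonNeighbours⇒td proper 2≤∣K∣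
              λ w w∉K → [ (λ w-alone → ⊥-elim (noneAlone (w , w∉K , w-alone))) , id ]′
                          (dominator⇒singletonOrSingletonNeighbour proper dom w w∉K)

lemma5 : ∀ {n : ℕ} (G : Graph n) (K : Subset n) →
         Connected G → IsSplitPartition G K → IsMaxClique G K → 2 ≤ ∣ K ∣ →
         (∀ k → IsChiD G k ⇔ IsChiTD G k)
lemma5 G K conn split _ 2≤∣K∣ k = mk⇔
  (λ (hasD , minD) → toTD hasD , λ m hasTD → minD m (td⇒dominator G hasTD))
  (λ (hasTD , minTD) → td⇒dominator G hasTD , λ m hasD → minTD m (toTD hasD))
  where
  toTD : ∀ {m} → HasDominatorColoring G m → HasTDColoring G m
  toTD = SplitGraph.dominator⇒td G K split 2≤∣K∣ conn
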